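{- Let $n\geq 3$ be odd and $\Gamma\cong \mathbb{Z}_{4n}\oplus \mathbb{Z}_n$. Then there exists a $\Gamma$-magic square $\mathrm{MS}_{\Gamma}(2n)$ of side $2n$.
   Context: For an Abelian group $(\Gamma,+)$ of order $N^2$, a $\Gamma$-magic square $\mathrm{MS}_{\Gamma}(N)$ (of side $N$) is an $N\times N$ array whose entries are all the elements of $\Gamma$ (each element appearing exactly once) such that all row sums, all column sums, the sum along the main diagonal and the sum along the backward main diagonal are equal to the same element $\mu\in\Gamma$. $\mathbb{Z}_r$ denotes the cyclic group of order $r$. -}

module Defs where

open import Data.Nat using (ℕ; zero; suc; _*_; NonZero)
import Data.Nat as ℕ
open import Data.Nat.DivMod using (_mod_)
open import Data.Fin using (Fin; toℕ; opposite)
import Data.Fin as Fin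
open import Data.Product using (_×_; _,_; proj₁; proj₂; Σ)
open import Function.Definitions using (Bijective)
open import Relation.Binary.PropositionalEquality using (_≡_)

ℤ_ : ℕ → Set
ℤ r = Fin r

-- addition in ℤ_r: a + b mod r (Fin 0 is empty, so r = 0 needs no case body)
addℤ : (r : ℕ) → ℤ r → ℤ r → ℤ r
addℤ (suc k) a b = (toℕ a ℕ.+ toℕ b) mod (suc k)

Γ : ℕ → Set
Γ n = ℤ (4 * n) × ℤ n

_⊕_ : {n : ℕ} → Γ n → Γ n → Γ n
_⊕_ {n} (a , b) (c , d) = addℤ (4 * n) a c , addℤ n b d

0Γ : (n : ℕ) .{{_ : NonZero n}} → Γ n
0Γ (suc m) = Fin.zero , Fin.zero

ΣΓ : (n : ℕ) .{{_ : NonZero n}} (N : ℕ) → (Fin N → Γ n) → Γ n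
ΣΓ n zero f = 0Γ n
ΣΓ n (suc N) f = f Fin.zero ⊕ ΣΓ n N (λ i → f (Fin.suc i))

-- A Γ-magic square MS_Γ(N): an N×N array M whose entries are all the
-- elements of Γ, each exactly once (the entry map (i,j) ↦ M i j is a
-- bijection Fin N × Fin N → Γ), such that all row sums, all column sums,
-- the main-diagonal sum and the backward-main-diagonal sum (entries
-- M i (N-1-i)) equal a common μ ∈ Γ.
IsMagicSquare : (n : ℕ) .{{_ : NonZero n}} (N : ℕ) → (Fin N → Fin N → Γ n) → Set
IsMagicSquare n N M =
  Bijective _≡_ _≡_ (λ (p : Fin N × Fin N) → M (proj₁ p) (proj₂ p))
  × Σ (Γ n) (λ μ →
      ((i : Fin N) → ΣΓ n N (λ j → M i j) ≡ μ)
    × ((j : Fin N) → ΣΓ n N (λ i → M i j) ≡ μ)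
    × (ΣΓ n N (λ i → M i i) ≡ μ)
    × (ΣΓ n N (λ i → M i (opposite i)) ≡ μ))

-- Write n = 2m + 1 and cut the 2n × 2n square into n² blocks of size 2 × 2, block (x, y)
-- covering rows 2x, 2x+1 and columns 2y, 2y+1. The cell (2x+ι, 2y+κ) receives
-- (h·n + 4x mod 4n, y mod n), where h = tile t ι κ ∈ {0,1,2,3} and the tile t, a 2 × 2
-- arrangement of 0,1,2,3, depends on the block. Since gcd(n, 4) = 1, h·n + 4x determines h and
-- x (Chinese remainders), so all entries differ. Along every line the x's and y's sum to
-- multiples of n, so a line sums to μ = ((n+2)·n, 0) as soon as its h's sum to n + 2 mod 4.
-- The plain tile achieves this for rows and columns; the diag tile, put on both block
-- diagonals, achieves it for the diagonals but upsets the middle block row and column, which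
-- one rowFix tile at (m, 0) and two colFix tiles at (0, m) and (2m, m) repair.

module Submission where

open import Defs
open import Data.Nat using (ℕ; _≤_; _*_; NonZero)
open import Data.Fin using (Fin)
open import Data.Product using (Σ)
open import Relation.Nullary using (¬_)
open import Data.Nat.Divisibility using (_∣_)

open import Data.Bool using (Bool; true; false; T; _∧_; _∨_)
open import Data.Bool.Properties using (T-∧; ∨-identityʳ; ∨-idem; ∨-zeroʳ)
open import Data.Empty using (⊥; ⊥-elim)
open import Data.Fin as Fin using (toℕ; opposite; punchOut)
open import Data.Fin.Patterns using (0F; 1F; 2F; 3F)
open import Data.Fin.Properties
  using (toℕ-injective; toℕ<n; toℕ-fromℕ<; fromℕ<-cong; fromℕ<-injective; opposite-prop;
         punchOut-injective; injective⇒≤; any?; *↔×)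
  renaming (_≟_ to _≟ᶠ_)
open import Data.Nat
  using (zero; suc; _+_; _∸_; _<_; _≡ᵇ_; _%_; z≤n; s≤s; s≤s⁻¹; z<s; s<s; s<s⁻¹; ⌊_/2⌋; parity)
open import Data.Nat.DivMod
open import Data.Nat.Divisibility using (divides; n∣m*n; n∣m*n*o)
open import Data.Nat.Properties
open import Data.Nat.Tactic.RingSolver using (solve-∀)
open import Algebra.Properties.CommutativeSemigroup +-commutativeSemigroup using (interchange)
open import Data.Parity.Base using (Parity; 0ℙ; 1ℙ; _⁻¹)
open import Data.Product using (_×_; _,_; proj₁; proj₂; ∃; map₂)
open import Data.Product.Properties using (,-injective)
open import Function using (_∘_; _↔_; Inverse; Injection)
open import Function.Properties.Inverse using (↔⇒↣)
open import Function.Construct.Symmetry using (↔-sym)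
open import Function.Definitions using (Injective; Surjective; Bijective)
open import Function.Bundles using (Equivalence)
open import Relation.Binary.PropositionalEquality
open import Relation.Nullary using (yes; no; contradiction)
open import Relation.Nullary.Decidable using (dec-true; dec-false)

∑< : ℕ → (ℕ → ℕ) → ℕ
∑< zero    f = 0
∑< (suc N) f = f 0 + ∑< N (f ∘ suc)

syntax ∑< N (λ k → e) = ∑[ k < N ] e

∑-cong : ∀ N {f g : ℕ → ℕ} → (∀ k → k < N → f k ≡ g k) → ∑< N f ≡ ∑< N g
∑-cong zero    _  = refl
∑-cong (suc N) eq = cong₂ _+_ (eq 0 z<s) (∑-cong N (λ k k<N → eq (suc k) (s<s k<N)))

∑-distrib-+ : ∀ N (f g : ℕ → ℕ) → ∑[ k < N ] (f k + g k) ≡ ∑< N f + ∑< N g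
∑-distrib-+ zero    f g = refl
∑-distrib-+ (suc N) f g =
  trans (cong (f 0 + g 0 +_) (∑-distrib-+ N (f ∘ suc) (g ∘ suc))) (interchange (f 0) (g 0) _ _)

*-distribʳ-∑ : ∀ N a (f : ℕ → ℕ) → ∑[ k < N ] (f k * a) ≡ ∑< N f * a
*-distribʳ-∑ zero    a f = refl
*-distribʳ-∑ (suc N) a f =
  trans (cong (f 0 * a +_) (*-distribʳ-∑ N a (f ∘ suc))) (sym (*-distribʳ-+ a (f 0) _))

∑-const : ∀ N a → ∑[ k < N ] a ≡ N * a
∑-const zero    a = refl
∑-const (suc N) a = cong (a +_) (∑-const N a)

∑-complementary : ∀ N c (f g : ℕ → ℕ) → (∀ k → f k + g k ≡ c) → ∑< N f + ∑< N g ≡ N * c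
∑-complementary N c f g f+g≡c =
  trans (sym (∑-distrib-+ N f g)) (trans (∑-cong N (λ k _ → f+g≡c k)) (∑-const N c))

∑-snoc : ∀ N (f : ℕ → ℕ) → ∑< (suc N) f ≡ ∑< N f + f N
∑-snoc zero    f = +-identityʳ (f 0)
∑-snoc (suc N) f = trans (cong (f 0 +_) (∑-snoc N (f ∘ suc))) (sym (+-assoc (f 0) _ _))

∑-reverse : ∀ N (f : ℕ → ℕ) → ∑[ k < N ] f (N ∸ suc k) ≡ ∑< N f
∑-reverse zero    f = refl
∑-reverse (suc N) f =
  trans (cong (f N +_) (∑-reverse N f)) (trans (+-comm (f N) _) (sym (∑-snoc N f)))

∑-double : ∀ N → ∑[ x < suc N ] (x + x) ≡ N * suc N
∑-double zero    = refl
∑-double (suc N) = begin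
  ∑[ x < suc (suc N) ] (x + x)             ≡⟨ ∑-snoc (suc N) (λ x → x + x) ⟩
  ∑[ x < suc N ] (x + x) + (suc N + suc N) ≡⟨ cong (_+ (suc N + suc N)) (∑-double N) ⟩
  N * suc N + (suc N + suc N)              ≡⟨ step N ⟩
  suc N * suc (suc N)                      ∎
  where
  open ≡-Reasoning
  step : ∀ N → N * suc N + (suc N + suc N) ≡ suc N * suc (suc N)
  step = solve-∀

𝟙 : Bool → ℕ
𝟙 true  = 1
𝟙 false = 0

≡ᵇ-comm : ∀ a b → (a ≡ᵇ b) ≡ (b ≡ᵇ a)
≡ᵇ-comm zero    zero    = refl
≡ᵇ-comm zero    (suc b) = refl
≡ᵇ-comm (suc a) zero    = refl
≡ᵇ-comm (suc a) (suc b) = ≡ᵇ-comm a b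

+-≡ᵇ-∸ : ∀ {a c} b → a ≤ c → (a + b ≡ᵇ c) ≡ (b ≡ᵇ c ∸ a)
+-≡ᵇ-∸ b z≤n       = refl
+-≡ᵇ-∸ b (s≤s a≤c) = +-≡ᵇ-∸ b a≤c

≡ᵇ-refl : ∀ a → (a ≡ᵇ a) ≡ true
≡ᵇ-refl a = dec-true (a ≟ a) refl

≢⇒≡ᵇ-false : ∀ {a b} → a ≢ b → (a ≡ᵇ b) ≡ false
≢⇒≡ᵇ-false {a} {b} = dec-false (a ≟ b)

∑-𝟙-≡ᵇ : ∀ N {a} → a < N → ∑[ k < N ] 𝟙 (k ≡ᵇ a) ≡ 1
∑-𝟙-≡ᵇ (suc N) {zero}  _         = cong suc (trans (∑-const N 0) (*-zeroʳ N))
∑-𝟙-≡ᵇ (suc N) {suc a} (s<s a<N) = ∑-𝟙-≡ᵇ N a<N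

∑-𝟙-pair : ∀ N {a b} → a ≢ b → a < N → b < N → ∑[ k < N ] 𝟙 ((k ≡ᵇ a) ∨ (k ≡ᵇ b)) ≡ 2
∑-𝟙-pair N {a} {b} a≢b a<N b<N = begin
  ∑[ k < N ] 𝟙 ((k ≡ᵇ a) ∨ (k ≡ᵇ b))      ≡⟨ ∑-cong N (λ k _ → split k) ⟩
  ∑[ k < N ] (𝟙 (k ≡ᵇ a) + 𝟙 (k ≡ᵇ b))    ≡⟨ ∑-distrib-+ N _ _ ⟩
  ∑[ k < N ] 𝟙 (k ≡ᵇ a) + ∑[ k < N ] 𝟙 (k ≡ᵇ b) ≡⟨ cong₂ _+_ (∑-𝟙-≡ᵇ N a<N) (∑-𝟙-≡ᵇ N b<N) ⟩
  2                                        ∎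
  where
  open ≡-Reasoning
  split : ∀ k → 𝟙 ((k ≡ᵇ a) ∨ (k ≡ᵇ b)) ≡ 𝟙 (k ≡ᵇ a) + 𝟙 (k ≡ᵇ b)
  split k with k ≟ a
  ... | yes refl rewrite ≡ᵇ-refl k | ≢⇒≡ᵇ-false a≢b = refl
  ... | no k≢a   rewrite ≢⇒≡ᵇ-false k≢a = refl

fromHalf : ℕ → Parity → ℕ
fromHalf zero    0ℙ = 0
fromHalf zero    1ℙ = 1
fromHalf (suc x) ι  = suc (suc (fromHalf x ι))

⌊fromHalf/2⌋ : ∀ x ι → ⌊ fromHalf x ι /2⌋ ≡ x
⌊fromHalf/2⌋ zero    0ℙ = refl
⌊fromHalf/2⌋ zero    1ℙ = refl
⌊fromHalf/2⌋ (suc x) ι  = cong suc (⌊fromHalf/2⌋ x ι)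

parity-fromHalf : ∀ x ι → parity (fromHalf x ι) ≡ ι
parity-fromHalf zero    0ℙ = refl
parity-fromHalf zero    1ℙ = refl
parity-fromHalf (suc x) ι  = parity-fromHalf x ι

fromHalf-⌊/2⌋ : ∀ r → fromHalf ⌊ r /2⌋ (parity r) ≡ r
fromHalf-⌊/2⌋ zero          = refl
fromHalf-⌊/2⌋ (suc zero)    = refl
fromHalf-⌊/2⌋ (suc (suc r)) = cong (suc ∘ suc) (fromHalf-⌊/2⌋ r)

⌊/2⌋-parity-injective : ∀ {r r′} → ⌊ r /2⌋ ≡ ⌊ r′ /2⌋ → parity r ≡ parity r′ → r ≡ r′
⌊/2⌋-parity-injective {r} {r′} x≡ ι≡ =
  trans (sym (fromHalf-⌊/2⌋ r)) (trans (cong₂ fromHalf x≡ ι≡) (fromHalf-⌊/2⌋ r′))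

fromHalf-0ℙ : ∀ x → fromHalf x 0ℙ ≡ 2 * x
fromHalf-0ℙ zero    = refl
fromHalf-0ℙ (suc x) = trans (cong (suc ∘ suc) (fromHalf-0ℙ x)) (sym (*-suc 2 x))

fromHalf-1ℙ : ∀ x → fromHalf x 1ℙ ≡ suc (2 * x)
fromHalf-1ℙ zero    = refl
fromHalf-1ℙ (suc x) = trans (cong (suc ∘ suc) (fromHalf-1ℙ x)) (cong suc (sym (*-suc 2 x)))

⌊/2⌋-< : ∀ N {r} → r < 2 * N → ⌊ r /2⌋ < N
⌊/2⌋-< (suc N) {zero}        _ = z<s
⌊/2⌋-< (suc N) {suc zero}    _ = z<s
⌊/2⌋-< (suc N) {suc (suc r)} r<2N
  rewrite *-suc 2 N = s<s (⌊/2⌋-< N (s<s⁻¹ (s<s⁻¹ r<2N)))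

fromHalf-reflect : ∀ N {x} ι → x < N → 2 * N ∸ suc (fromHalf x ι) ≡ fromHalf (N ∸ suc x) (ι ⁻¹)
fromHalf-reflect (suc N) {x} ι x<N = trans (cong (_∸ suc (fromHalf x ι)) (*-suc 2 N)) (step x ι x<N)
  where
  step : ∀ x ι → x < suc N → 2 + 2 * N ∸ suc (fromHalf x ι) ≡ fromHalf (N ∸ x) (ι ⁻¹)
  step zero    0ℙ _         = sym (fromHalf-1ℙ N)
  step zero    1ℙ _         = sym (fromHalf-0ℙ N)
  step (suc x) ι  (s<s x<N) = fromHalf-reflect N ι x<N

∑-halves : ∀ N (f : ℕ → ℕ) → ∑< (2 * N) f ≡ ∑[ x < N ] (f (fromHalf x 0ℙ) + f (fromHalf x 1ℙ))
∑-halves zero    f = refl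
∑-halves (suc N) f = begin
  ∑< (2 * suc N) f                                   ≡⟨ cong (λ M → ∑< M f) (*-suc 2 N) ⟩
  f 0 + (f 1 + ∑< (2 * N) (f ∘ suc ∘ suc))           ≡⟨ sym (+-assoc (f 0) (f 1) _) ⟩
  f 0 + f 1 + ∑< (2 * N) (f ∘ suc ∘ suc)             ≡⟨ cong (f 0 + f 1 +_) (∑-halves N (f ∘ suc ∘ suc)) ⟩
  ∑[ x < suc N ] (f (fromHalf x 0ℙ) + f (fromHalf x 1ℙ)) ∎
  where open ≡-Reasoning

∑-halves′ : ∀ N (g : ℕ → Parity → ℕ) → ∑[ c < 2 * N ] g ⌊ c /2⌋ (parity c) ≡ ∑[ x < N ] (g x 0ℙ + g x 1ℙ)
∑-halves′ N g = trans (∑-halves N _) (∑-cong N (λ x _ → cong₂ _+_ (half 0ℙ) (half 1ℙ)))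
  where
  half : ∀ {x} ι → g ⌊ fromHalf x ι /2⌋ (parity (fromHalf x ι)) ≡ g x ι
  half {x} ι = cong₂ g (⌊fromHalf/2⌋ x ι) (parity-fromHalf x ι)

%-cong-∣ : ∀ {d K} .{{_ : NonZero d}} .{{_ : NonZero K}} {a b} → d ∣ K → a % K ≡ b % K → a % d ≡ b % d
%-cong-∣ {d} {K} {a} {b} d∣K eq = begin
  a % d     ≡⟨ sym (m∣n⇒o%n%m≡o%m d K a d∣K) ⟩
  a % K % d ≡⟨ cong (_% d) eq ⟩
  b % K % d ≡⟨ m∣n⇒o%n%m≡o%m d K b d∣K ⟩
  b % d     ∎
  where open ≡-Reasoning

%-*-cong : ∀ {K} .{{_ : NonZero K}} a b c e → a % K ≡ b % K → c % K ≡ e % K → (a * c) % K ≡ (b * e) % K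
%-*-cong {K} a b c e a≡b c≡e = begin
  (a * c) % K               ≡⟨ %-distribˡ-* a c K ⟩
  ((a % K) * (c % K)) % K   ≡⟨ cong₂ (λ u v → (u * v) % K) a≡b c≡e ⟩
  ((b % K) * (e % K)) % K   ≡⟨ %-distribˡ-* b e K ⟨
  (b * e) % K               ∎
  where open ≡-Reasoning

*-cancelʳ-unit-% : ∀ {K} .{{_ : NonZero K}} {u w a b} → (u * w) % K ≡ 1 % K →
                   (a * u) % K ≡ (b * u) % K → a % K ≡ b % K
*-cancelʳ-unit-% {K} {u} {w} {a} {b} uw≡1 au≡bu = begin
  a % K               ≡⟨ cong (_% K) (*-identityʳ a) ⟨
  (a * 1) % K         ≡⟨ %-*-cong a a 1 (u * w) refl (sym uw≡1) ⟩
  (a * (u * w)) % K   ≡⟨ cong (_% K) (*-assoc a u w) ⟨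
  (a * u * w) % K     ≡⟨ %-*-cong (a * u) (b * u) w w au≡bu refl ⟩
  (b * u * w) % K     ≡⟨ cong (_% K) (*-assoc b u w) ⟩
  (b * (u * w)) % K   ≡⟨ %-*-cong b b (u * w) 1 refl uw≡1 ⟩
  (b * 1) % K         ≡⟨ cong (_% K) (*-identityʳ b) ⟩
  b % K               ∎
  where open ≡-Reasoning

crt-injective : ∀ K L .{{_ : NonZero K}} .{{_ : NonZero L}} .{{_ : NonZero (K * L)}} {u v a a′ b b′} →
                (L * u) % K ≡ 1 % K → (K * v) % L ≡ 1 % L →
                a < K → a′ < K → b < L → b′ < L →
                (a * L + b * K) % (K * L) ≡ (a′ * L + b′ * K) % (K * L) → a ≡ a′ × b ≡ b′
crt-injective K L {a = a} {a′} {b} {b′} Lu≡1 Kv≡1 a<K a′<K b<L b′<L eq =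
  cancel Lu≡1 a<K a′<K modK , cancel Kv≡1 b<L b′<L modL
  where
  cancel : ∀ {M u w x x′} .{{_ : NonZero M}} → (u * w) % M ≡ 1 % M → x < M → x′ < M →
           (x * u) % M ≡ (x′ * u) % M → x ≡ x′
  cancel uw≡1 x<M x′<M xu≡x′u = trans (sym (m<n⇒m%n≡m x<M))
    (trans (*-cancelʳ-unit-% uw≡1 xu≡x′u) (m<n⇒m%n≡m x′<M))
  modK : (a * L) % K ≡ (a′ * L) % K
  modK = trans (sym (%-remove-+ʳ (a * L) (n∣m*n b)))
           (trans (%-cong-∣ (divides L (*-comm K L)) eq) (%-remove-+ʳ (a′ * L) (n∣m*n b′)))
  modL : (b * K) % L ≡ (b′ * K) % L
  modL = trans (sym (%-remove-+ˡ (b * K) (n∣m*n a)))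
           (trans (%-cong-∣ (n∣m*n K) eq) (%-remove-+ˡ (b′ * K) (n∣m*n a′)))

mod-≡ : ∀ {K} .{{_ : NonZero K}} a b → a % K ≡ b % K → a mod K ≡ b mod K
mod-≡ a b eq = fromℕ<-cong _ _ eq _ _

mod-injective : ∀ {K} .{{_ : NonZero K}} {a b} → a < K → b < K → a mod K ≡ b mod K → a ≡ b
mod-injective a<K b<K eq =
  trans (sym (m<n⇒m%n≡m a<K)) (trans (fromℕ<-injective _ _ _ _ eq) (m<n⇒m%n≡m b<K))

addℤ-mod : ∀ K a b → addℤ (suc K) (a mod suc K) (b mod suc K) ≡ (a + b) mod suc K
addℤ-mod K a b = mod-≡ (toℕ (a mod suc K) + toℕ (b mod suc K)) (a + b) (begin
  (toℕ (a mod suc K) + toℕ (b mod suc K)) % suc K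
    ≡⟨ cong₂ (λ u v → (u + v) % suc K) (toℕ-fromℕ< (m%n<n a (suc K))) (toℕ-fromℕ< (m%n<n b (suc K))) ⟩
  (a % suc K + b % suc K) % suc K
    ≡⟨ %-distribˡ-+ a b (suc K) ⟨
  (a + b) % suc K ∎)
  where open ≡-Reasoning

injective⇒surjective : ∀ {k} {f : Fin k → Fin k} → Injective _≡_ _≡_ f → Surjective _≡_ _≡_ f
injective⇒surjective {suc k} {f} f-inj y with any? (λ x → f x ≟ᶠ y)
... | yes (x , fx≡y) = x , λ { refl → fx≡y }
... | no ∄x          = contradiction (injective⇒≤ {f = f′} f′-injective) 1+n≰n
  where
  f′ : Fin (suc k) → Fin k
  f′ x = punchOut {i = y} {j = f x} (λ y≡fx → ∄x (x , sym y≡fx))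
  f′-injective : Injective _≡_ _≡_ f′
  f′-injective {x} {x′} eq = f-inj (punchOut-injective {i = y} _ _ eq)

injective⇒bijective : ∀ {k} {A B : Set} → A ↔ Fin k → B ↔ Fin k →
                      {f : A → B} → Injective _≡_ _≡_ f → Bijective _≡_ _≡_ f
injective⇒bijective {k} α β {f} f-inj = f-inj , surjective
  where
  open Inverse
  to-injective : ∀ {C D : Set} (γ : C ↔ D) → Injective _≡_ _≡_ (to γ)
  to-injective γ = Injection.injective (↔⇒↣ γ)
  g : Fin k → Fin k
  g = to β ∘ f ∘ from α
  g-injective : Injective _≡_ _≡_ g
  g-injective = to-injective (↔-sym α) ∘ f-inj ∘ to-injective β
  surjective : Surjective _≡_ _≡_ f
  surjective y with injective⇒surjective g-injective (to β y)
  ... | i , gi≡y = from α i , λ { refl → to-injective β (gi≡y refl) }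

data Tile : Set where
  plain diag colFix rowFix : Tile

tile : Tile → Parity → Parity → Fin 4
tile plain  0ℙ 0ℙ = 0F
tile plain  0ℙ 1ℙ = 1F
tile plain  1ℙ 0ℙ = 3F
tile plain  1ℙ 1ℙ = 2F
tile diag   0ℙ 0ℙ = 0F
tile diag   0ℙ 1ℙ = 2F
tile diag   1ℙ 0ℙ = 1F
tile diag   1ℙ 1ℙ = 3F
tile colFix 0ℙ 0ℙ = 0F
tile colFix 0ℙ 1ℙ = 1F
tile colFix 1ℙ 0ℙ = 2F
tile colFix 1ℙ 1ℙ = 3F
tile rowFix 0ℙ 0ℙ = 0F
tile rowFix 0ℙ 1ℙ = 2F
tile rowFix 1ℙ 0ℙ = 3F
tile rowFix 1ℙ 1ℙ = 1F

unTile : Tile → Fin 4 → Parity × Parity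
unTile plain  0F = 0ℙ , 0ℙ
unTile plain  1F = 0ℙ , 1ℙ
unTile plain  2F = 1ℙ , 1ℙ
unTile plain  3F = 1ℙ , 0ℙ
unTile diag   0F = 0ℙ , 0ℙ
unTile diag   1F = 1ℙ , 0ℙ
unTile diag   2F = 0ℙ , 1ℙ
unTile diag   3F = 1ℙ , 1ℙ
unTile colFix 0F = 0ℙ , 0ℙ
unTile colFix 1F = 0ℙ , 1ℙ
unTile colFix 2F = 1ℙ , 0ℙ
unTile colFix 3F = 1ℙ , 1ℙ
unTile rowFix 0F = 0ℙ , 0ℙ
unTile rowFix 1F = 1ℙ , 1ℙ
unTile rowFix 2F = 0ℙ , 1ℙ
unTile rowFix 3F = 1ℙ , 0ℙ

unTile-tile : ∀ t ι κ → unTile t (tile t ι κ) ≡ (ι , κ)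
unTile-tile plain  0ℙ 0ℙ = refl
unTile-tile plain  0ℙ 1ℙ = refl
unTile-tile plain  1ℙ 0ℙ = refl
unTile-tile plain  1ℙ 1ℙ = refl
unTile-tile diag   0ℙ 0ℙ = refl
unTile-tile diag   0ℙ 1ℙ = refl
unTile-tile diag   1ℙ 0ℙ = refl
unTile-tile diag   1ℙ 1ℙ = refl
unTile-tile colFix 0ℙ 0ℙ = refl
unTile-tile colFix 0ℙ 1ℙ = refl
unTile-tile colFix 1ℙ 0ℙ = refl
unTile-tile colFix 1ℙ 1ℙ = refl
unTile-tile rowFix 0ℙ 0ℙ = refl
unTile-tile rowFix 0ℙ 1ℙ = refl
unTile-tile rowFix 1ℙ 0ℙ = refl
unTile-tile rowFix 1ℙ 1ℙ = refl

tile-injective : ∀ t {ι κ ι′ κ′} → tile t ι κ ≡ tile t ι′ κ′ → ι ≡ ι′ × κ ≡ κ′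
tile-injective t {ι} {κ} {ι′} {κ′} eq =
  ,-injective (trans (sym (unTile-tile t ι κ)) (trans (cong (unTile t) eq) (unTile-tile t ι′ κ′)))

tileRowSum : Parity → Tile → ℕ
tileRowSum ι t = toℕ (tile t ι 0ℙ) + toℕ (tile t ι 1ℙ)

tileColSum : Parity → Tile → ℕ
tileColSum κ t = toℕ (tile t 0ℙ κ) + toℕ (tile t 1ℙ κ)

tileRowSum-total : ∀ t → tileRowSum 1ℙ t + tileRowSum 0ℙ t ≡ 6
tileRowSum-total plain  = refl
tileRowSum-total diag   = refl
tileRowSum-total colFix = refl
tileRowSum-total rowFix = refl

tileColSum-total : ∀ t → tileColSum 0ℙ t + tileColSum 1ℙ t ≡ 6
tileColSum-total plain  = refl
tileColSum-total diag   = refl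
tileColSum-total colFix = refl
tileColSum-total rowFix = refl

-- As every tile sums to 6, the two rows (columns) of a block row (column) together sum to
-- 6n; this moves the residue n + 2 mod 4 from one of them to the other.
residue-complement : ∀ {n A B j j′} → n ≡ suc (j + j′) → A + B ≡ n * 6 → B ≡ n + 2 + j * 4 →
                     A ≡ n + 2 + j′ * 4
residue-complement {A = A} {j = j} {j′} refl A+B≡6n refl = +-cancelʳ-≡ _ A _ (trans A+B≡6n (split j j′))
  where
  split : ∀ j j′ → suc (j + j′) * 6 ≡ (suc (j + j′) + 2 + j′ * 4) + (suc (j + j′) + 2 + j * 4)
  split = solve-∀

classify : Bool → Bool → Bool → Tile
classify true  _     _     = diag
classify false true  _     = colFix
classify false false true  = rowFix
classify false false false = plain

tileRowSum-classify : ∀ d c r → (T r → T c → ⊥) → tileRowSum 0ℙ (classify d c r) ≡ 1 + 𝟙 (d ∨ r)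
tileRowSum-classify true  _     _     _  = refl
tileRowSum-classify false true  true  rc = ⊥-elim (rc _ _)
tileRowSum-classify false true  false _  = refl
tileRowSum-classify false false true  _  = refl
tileRowSum-classify false false false _  = refl

tileColSum-classify : ∀ d c r → (T c → T d → ⊥) → tileColSum 1ℙ (classify d c r) ≡ 3 + (𝟙 d * 2 + 𝟙 c)
tileColSum-classify true  true  _     cd = ⊥-elim (cd _ _)
tileColSum-classify true  false _     _  = refl
tileColSum-classify false true  _     _  = refl
tileColSum-classify false false true  _  = refl
tileColSum-classify false false false _  = refl

module Construction (k : ℕ) where

  m : ℕ
  m = suc k

  2m : ℕ
  2m = 2 * m

  n : ℕ
  n = suc 2m

  isDiag isColFix isRowFix : ℕ → ℕ → Bool
  isDiag   x y = (x ≡ᵇ y) ∨ (x + y ≡ᵇ 2m)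
  isColFix x y = (y ≡ᵇ m) ∧ ((x ≡ᵇ 0) ∨ (x ≡ᵇ 2m))
  isRowFix x y = (x ≡ᵇ m) ∧ (y ≡ᵇ 0)

  tileAt : ℕ → ℕ → Tile
  tileAt x y = classify (isDiag x y) (isColFix x y) (isRowFix x y)

  m≤2m : m ≤ 2m
  m≤2m = m≤m+n m (m + 0)

  m≢2m : m ≢ 2m
  m≢2m eq with +-cancelˡ-≡ m 0 (m + 0) (trans (+-identityʳ m) eq)
  ... | ()

  isDiag-comm : ∀ x y → isDiag x y ≡ isDiag y x
  isDiag-comm x y = cong₂ _∨_ (≡ᵇ-comm x y) (cong (_≡ᵇ 2m) (+-comm x y))

  isDiag-row : ∀ {x} y → x ≤ 2m → isDiag x y ≡ (y ≡ᵇ x) ∨ (y ≡ᵇ 2m ∸ x)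
  isDiag-row {x} y x≤2m = cong₂ _∨_ (≡ᵇ-comm x y) (+-≡ᵇ-∸ y x≤2m)

  isDiag-centre : ∀ y → isDiag m y ≡ (y ≡ᵇ m)
  isDiag-centre y = begin
    isDiag m y               ≡⟨ isDiag-row y m≤2m ⟩
    (y ≡ᵇ m) ∨ (y ≡ᵇ 2m ∸ m) ≡⟨ cong (λ z → (y ≡ᵇ m) ∨ (y ≡ᵇ z)) (trans (m+n∸m≡n m (m + 0)) (+-identityʳ m)) ⟩
    (y ≡ᵇ m) ∨ (y ≡ᵇ m)      ≡⟨ ∨-idem _ ⟩
    y ≡ᵇ m                   ∎
    where open ≡-Reasoning

  reflect-≢ : ∀ {x} → x ≤ 2m → x ≢ m → x ≢ 2m ∸ x
  reflect-≢ {x} x≤2m x≢m x≡2m∸x =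
    x≢m (*-cancelˡ-≡ x m 2 (trans (cong (x +_) (trans (+-identityʳ x) x≡2m∸x)) (m+[n∸m]≡n x≤2m)))

  rowFix-colFix-disjoint : ∀ x y → T (isRowFix x y) → T (isColFix x y) → ⊥
  rowFix-colFix-disjoint x y rf with ≡ᵇ⇒≡ y 0 (proj₂ (Equivalence.to T-∧ rf))
  ... | refl = λ ()

  colFix-diag-disjoint : ∀ x y → T (isColFix x y) → T (isDiag x y) → ⊥
  colFix-diag-disjoint x y cf d with Equivalence.to T-∧ cf
  ... | y≡ᵇm , x∈ends with ≡ᵇ⇒≡ y m y≡ᵇm
  ... | refl with ≡ᵇ⇒≡ x m (subst T (trans (isDiag-comm x m) (isDiag-centre x)) d)
  ... | refl = m≢2m (≡ᵇ⇒≡ m 2m x∈ends)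

  rowExcess : ∀ x → x < n → ∑[ y < n ] 𝟙 (isDiag x y ∨ isRowFix x y) ≡ 2
  rowExcess x x<n with x ≟ m
  ... | yes refl = trans (∑-cong n (λ y _ → cong 𝟙 (centre y))) (∑-𝟙-pair n (λ ()) (s≤s m≤2m) z<s)
    where
    centre : ∀ y → isDiag m y ∨ isRowFix m y ≡ (y ≡ᵇ m) ∨ (y ≡ᵇ 0)
    centre y = cong₂ _∨_ (isDiag-centre y) (cong (_∧ (y ≡ᵇ 0)) (≡ᵇ-refl m))
  ... | no x≢m = trans (∑-cong n (λ y _ → cong 𝟙 (offCentre y)))
                       (∑-𝟙-pair n (reflect-≢ x≤2m x≢m) x<n (s≤s (m∸n≤m 2m x)))
    where
    x≤2m : x ≤ 2m
    x≤2m = s≤s⁻¹ x<n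
    offCentre : ∀ y → isDiag x y ∨ isRowFix x y ≡ (y ≡ᵇ x) ∨ (y ≡ᵇ 2m ∸ x)
    offCentre y = begin
      isDiag x y ∨ ((x ≡ᵇ m) ∧ (y ≡ᵇ 0)) ≡⟨ cong (λ b → isDiag x y ∨ (b ∧ (y ≡ᵇ 0))) (≢⇒≡ᵇ-false x≢m) ⟩
      isDiag x y ∨ false                 ≡⟨ ∨-identityʳ _ ⟩
      isDiag x y                         ≡⟨ isDiag-row y x≤2m ⟩
      (y ≡ᵇ x) ∨ (y ≡ᵇ 2m ∸ x)          ∎
      where open ≡-Reasoning

  colExcess : ∀ y → y < n → ∑[ x < n ] (𝟙 (isDiag x y) * 2 + 𝟙 (isColFix x y)) ≡ 4
  colExcess y y<n with y ≟ m
  ... | yes refl = begin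
    ∑[ x < n ] (𝟙 (isDiag x m) * 2 + 𝟙 (isColFix x m))
      ≡⟨ ∑-cong n (λ x _ → cong₂ (λ d c → 𝟙 d * 2 + 𝟙 c) (trans (isDiag-comm x m) (isDiag-centre x))
                                                         (cong (_∧ ((x ≡ᵇ 0) ∨ (x ≡ᵇ 2m))) (≡ᵇ-refl m))) ⟩
    ∑[ x < n ] (𝟙 (x ≡ᵇ m) * 2 + 𝟙 ((x ≡ᵇ 0) ∨ (x ≡ᵇ 2m)))
      ≡⟨ ∑-distrib-+ n (λ x → 𝟙 (x ≡ᵇ m) * 2) (λ x → 𝟙 ((x ≡ᵇ 0) ∨ (x ≡ᵇ 2m))) ⟩
    ∑[ x < n ] (𝟙 (x ≡ᵇ m) * 2) + ∑[ x < n ] 𝟙 ((x ≡ᵇ 0) ∨ (x ≡ᵇ 2m))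
      ≡⟨ cong₂ _+_ (trans (*-distribʳ-∑ n 2 (λ x → 𝟙 (x ≡ᵇ m))) (cong (_* 2) (∑-𝟙-≡ᵇ n (s≤s m≤2m))))
                   (∑-𝟙-pair n (λ ()) z<s ≤-refl) ⟩
    4 ∎
    where open ≡-Reasoning
  ... | no y≢m = begin
    ∑[ x < n ] (𝟙 (isDiag x y) * 2 + 𝟙 (isColFix x y))
      ≡⟨ ∑-cong n (λ x _ → cong₂ (λ d c → 𝟙 d * 2 + 𝟙 c) (trans (isDiag-comm x y) (isDiag-row x y≤2m))
                                                         (cong (_∧ ((x ≡ᵇ 0) ∨ (x ≡ᵇ 2m))) (≢⇒≡ᵇ-false y≢m))) ⟩
    ∑[ x < n ] (𝟙 ((x ≡ᵇ y) ∨ (x ≡ᵇ 2m ∸ y)) * 2 + 0)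
      ≡⟨ ∑-cong n (λ x _ → +-identityʳ (𝟙 ((x ≡ᵇ y) ∨ (x ≡ᵇ 2m ∸ y)) * 2)) ⟩
    ∑[ x < n ] (𝟙 ((x ≡ᵇ y) ∨ (x ≡ᵇ 2m ∸ y)) * 2)
      ≡⟨ *-distribʳ-∑ n 2 (λ x → 𝟙 ((x ≡ᵇ y) ∨ (x ≡ᵇ 2m ∸ y))) ⟩
    ∑[ x < n ] 𝟙 ((x ≡ᵇ y) ∨ (x ≡ᵇ 2m ∸ y)) * 2
      ≡⟨ cong (_* 2) (∑-𝟙-pair n (reflect-≢ y≤2m y≢m) y<n (s≤s (m∸n≤m 2m y))) ⟩
    4 ∎
    where
    open ≡-Reasoning
    y≤2m : y ≤ 2m
    y≤2m = s≤s⁻¹ y<n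

  rowTiles-0ℙ : ∀ {x} → x < n → ∑[ y < n ] tileRowSum 0ℙ (tileAt x y) ≡ n + 2 + 0 * 4
  rowTiles-0ℙ {x} x<n = begin
    ∑[ y < n ] tileRowSum 0ℙ (tileAt x y)
      ≡⟨ ∑-cong n (λ y _ → tileRowSum-classify (isDiag x y) (isColFix x y) (isRowFix x y)
                                                (rowFix-colFix-disjoint x y)) ⟩
    ∑[ y < n ] (1 + 𝟙 (isDiag x y ∨ isRowFix x y))
      ≡⟨ ∑-distrib-+ n (λ _ → 1) (λ y → 𝟙 (isDiag x y ∨ isRowFix x y)) ⟩
    ∑[ y < n ] 1 + ∑[ y < n ] 𝟙 (isDiag x y ∨ isRowFix x y)
      ≡⟨ cong₂ _+_ (trans (∑-const n 1) (*-identityʳ n)) (rowExcess x x<n) ⟩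
    n + 2
      ≡⟨ +-identityʳ _ ⟨
    n + 2 + 0 * 4 ∎
    where open ≡-Reasoning

  rowTiles : ∀ {x} → x < n → ∀ ι → ∃ λ j → ∑[ y < n ] tileRowSum ι (tileAt x y) ≡ n + 2 + j * 4
  rowTiles x<n 0ℙ = 0 , rowTiles-0ℙ x<n
  rowTiles {x} x<n 1ℙ = 2m , residue-complement {j = 0} refl
    (∑-complementary n 6 (λ y → tileRowSum 1ℙ (tileAt x y)) (λ y → tileRowSum 0ℙ (tileAt x y))
                     (λ y → tileRowSum-total (tileAt x y))) (rowTiles-0ℙ x<n)

  colTiles-1ℙ : ∀ {y} → y < n → ∑[ x < n ] tileColSum 1ℙ (tileAt x y) ≡ n + 2 + suc m * 4
  colTiles-1ℙ {y} y<n = begin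
    ∑[ x < n ] tileColSum 1ℙ (tileAt x y)
      ≡⟨ ∑-cong n (λ x _ → tileColSum-classify (isDiag x y) (isColFix x y) (isRowFix x y)
                                                (colFix-diag-disjoint x y)) ⟩
    ∑[ x < n ] (3 + (𝟙 (isDiag x y) * 2 + 𝟙 (isColFix x y)))
      ≡⟨ ∑-distrib-+ n (λ _ → 3) (λ x → 𝟙 (isDiag x y) * 2 + 𝟙 (isColFix x y)) ⟩
    ∑[ x < n ] 3 + ∑[ x < n ] (𝟙 (isDiag x y) * 2 + 𝟙 (isColFix x y))
      ≡⟨ cong₂ _+_ (∑-const n 3) (colExcess y y<n) ⟩
    n * 3 + 4
      ≡⟨ regroup k ⟩
    n + 2 + suc m * 4 ∎
    where
    open ≡-Reasoning
    regroup : ∀ k → suc (2 * suc k) * 3 + 4 ≡ suc (2 * suc k) + 2 + suc (suc k) * 4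
    regroup = solve-∀

  colTiles : ∀ {y} → y < n → ∀ κ → ∃ λ j → ∑[ x < n ] tileColSum κ (tileAt x y) ≡ n + 2 + j * 4
  colTiles y<n 1ℙ = suc m , colTiles-1ℙ y<n
  colTiles {y} y<n 0ℙ = k , residue-complement {j = suc m} (n≡ k)
    (∑-complementary n 6 (λ x → tileColSum 0ℙ (tileAt x y)) (λ x → tileColSum 1ℙ (tileAt x y))
                     (λ x → tileColSum-total (tileAt x y))) (colTiles-1ℙ y<n)
    where
    n≡ : ∀ k → suc (2 * suc k) ≡ suc (suc (suc k) + k)
    n≡ = solve-∀

  cell : ℕ → Parity → ℕ → Parity → ℕ
  cell x ι y κ = toℕ (tile (tileAt x y) ι κ)

  level : ℕ → ℕ → ℕ
  level r c = cell ⌊ r /2⌋ (parity r) ⌊ c /2⌋ (parity c)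

  entry : ℕ → ℕ → Γ n
  entry r c = (level r c * n + ⌊ r /2⌋ * 4) mod (4 * n) , ⌊ c /2⌋ mod n

  square : Fin (2 * n) → Fin (2 * n) → Γ n
  square i j = entry (toℕ i) (toℕ j)

  μ : Γ n
  μ = (n + 2) * n mod (4 * n) , 0 mod n

  ΣΓ-mod : ∀ N (φ : Fin N → Γ n) (f g : ℕ → ℕ) →
           (∀ i → φ i ≡ (f (toℕ i) mod (4 * n) , g (toℕ i) mod n)) →
           ΣΓ n N φ ≡ (∑< N f mod (4 * n) , ∑< N g mod n)
  ΣΓ-mod zero    φ f g φ≡ = refl
  ΣΓ-mod (suc N) φ f g φ≡ =
    trans (cong₂ _⊕_ (φ≡ Fin.zero) (ΣΓ-mod N (φ ∘ Fin.suc) (f ∘ suc) (g ∘ suc) (φ≡ ∘ Fin.suc)))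
          (cong₂ _,_ (addℤ-mod _ (f 0) _) (addℤ-mod _ (g 0) _))

  magicLine : ∀ (φ : Fin (2 * n) → Γ n) (ρ γ : ℕ → ℕ) →
              (∀ t → φ t ≡ entry (ρ (toℕ t)) (γ (toℕ t))) →
              (∃ λ j → ∑[ t < 2 * n ] level (ρ t) (γ t) ≡ n + 2 + j * 4) →
              n ∣ ∑[ t < 2 * n ] ⌊ ρ t /2⌋ → n ∣ ∑[ t < 2 * n ] ⌊ γ t /2⌋ →
              ΣΓ n (2 * n) φ ≡ μ
  magicLine φ ρ γ φ≡ (j , levels≡) (divides q rows≡) (divides q′ cols≡) = begin
    ΣΓ n (2 * n) φ
      ≡⟨ ΣΓ-mod (2 * n) φ (λ t → level (ρ t) (γ t) * n + ⌊ ρ t /2⌋ * 4) (λ t → ⌊ γ t /2⌋) φ≡ ⟩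
    (∑[ t < 2 * n ] (level (ρ t) (γ t) * n + ⌊ ρ t /2⌋ * 4) mod (4 * n) , ∑[ t < 2 * n ] ⌊ γ t /2⌋ mod n)
      ≡⟨ cong₂ _,_ (cong (_mod (4 * n)) first) (cong (_mod n) cols≡) ⟩
    ((n + 2) * n + (j + q) * (4 * n)) mod (4 * n) , q′ * n mod n
      ≡⟨ cong₂ _,_ (mod-≡ ((n + 2) * n + (j + q) * (4 * n)) ((n + 2) * n)
                          ([m+kn]%n≡m%n ((n + 2) * n) (j + q) (4 * n)))
                   (mod-≡ (q′ * n) 0 (m*n%n≡0 q′ n)) ⟩
    μ ∎
    where
    open ≡-Reasoning
    regroup : ∀ n j q → (n + 2 + j * 4) * n + q * n * 4 ≡ (n + 2) * n + (j + q) * (4 * n)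
    regroup = solve-∀
    first : ∑[ t < 2 * n ] (level (ρ t) (γ t) * n + ⌊ ρ t /2⌋ * 4) ≡ (n + 2) * n + (j + q) * (4 * n)
    first = begin
      ∑[ t < 2 * n ] (level (ρ t) (γ t) * n + ⌊ ρ t /2⌋ * 4)
        ≡⟨ ∑-distrib-+ (2 * n) (λ t → level (ρ t) (γ t) * n) (λ t → ⌊ ρ t /2⌋ * 4) ⟩
      ∑[ t < 2 * n ] (level (ρ t) (γ t) * n) + ∑[ t < 2 * n ] (⌊ ρ t /2⌋ * 4)
        ≡⟨ cong₂ _+_ (*-distribʳ-∑ (2 * n) n (λ t → level (ρ t) (γ t)))
                     (*-distribʳ-∑ (2 * n) 4 (λ t → ⌊ ρ t /2⌋)) ⟩
      ∑[ t < 2 * n ] level (ρ t) (γ t) * n + ∑[ t < 2 * n ] ⌊ ρ t /2⌋ * 4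
        ≡⟨ cong₂ (λ a b → a * n + b * 4) levels≡ rows≡ ⟩
      (n + 2 + j * 4) * n + q * n * 4
        ≡⟨ regroup n j q ⟩
      (n + 2) * n + (j + q) * (4 * n) ∎

  n∣∑⌊/2⌋ : n ∣ ∑[ t < 2 * n ] ⌊ t /2⌋
  n∣∑⌊/2⌋ = divides 2m (trans (∑-halves′ n (λ x _ → x)) (∑-double 2m))

  n∣∑-const : ∀ a → n ∣ ∑[ t < 2 * n ] a
  n∣∑-const a = subst (n ∣_) (sym (∑-const (2 * n) a)) (n∣m*n*o 2 a)

  tileAt-diag : ∀ x y → isDiag x y ≡ true → tileAt x y ≡ diag
  tileAt-diag x y d = cong (λ b → classify b (isColFix x y) (isRowFix x y)) d

  level-fromHalf : ∀ x ι y κ → level (fromHalf x ι) (fromHalf y κ) ≡ cell x ι y κ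
  level-fromHalf x ι y κ = begin
    cell ⌊ fromHalf x ι /2⌋ (parity (fromHalf x ι)) ⌊ fromHalf y κ /2⌋ (parity (fromHalf y κ))
      ≡⟨ cong₂ (λ x′ ι′ → cell x′ ι′ _ _) (⌊fromHalf/2⌋ x ι) (parity-fromHalf x ι) ⟩
    cell x ι ⌊ fromHalf y κ /2⌋ (parity (fromHalf y κ))
      ≡⟨ cong₂ (cell x ι) (⌊fromHalf/2⌋ y κ) (parity-fromHalf y κ) ⟩
    cell x ι y κ ∎
    where open ≡-Reasoning

  rowLevels : ∀ r → r < 2 * n → ∃ λ j → ∑[ c < 2 * n ] level r c ≡ n + 2 + j * 4
  rowLevels r r<2n =
    map₂ (trans (∑-halves′ n (cell ⌊ r /2⌋ (parity r)))) (rowTiles (⌊/2⌋-< n r<2n) (parity r))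

  colLevels : ∀ c → c < 2 * n → ∃ λ j → ∑[ r < 2 * n ] level r c ≡ n + 2 + j * 4
  colLevels c c<2n =
    map₂ (trans (∑-halves′ n (λ x ι → cell x ι ⌊ c /2⌋ (parity c)))) (colTiles (⌊/2⌋-< n c<2n) (parity c))

  ∑-threes : ∀ (f : ℕ → ℕ) → (∀ x → x < n → f x ≡ 3) → ∑< n f ≡ n + 2 + m * 4
  ∑-threes f f≡3 = trans (∑-cong n f≡3) (trans (∑-const n 3) (regroup k))
    where
    regroup : ∀ k → suc (2 * suc k) * 3 ≡ suc (2 * suc k) + 2 + suc k * 4
    regroup = solve-∀

  diagLevels : ∃ λ j → ∑[ r < 2 * n ] level r r ≡ n + 2 + j * 4
  diagLevels = m , trans (∑-halves′ n (λ x ι → cell x ι x ι)) (∑-threes _ (λ x _ → diagonalTile x))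
    where
    diagonalTile : ∀ x → cell x 0ℙ x 0ℙ + cell x 1ℙ x 1ℙ ≡ 3
    diagonalTile x = cong (λ t → toℕ (tile t 0ℙ 0ℙ) + toℕ (tile t 1ℙ 1ℙ))
                          (tileAt-diag x x (cong (_∨ (x + x ≡ᵇ 2m)) (≡ᵇ-refl x)))

  antiLevels : ∃ λ j → ∑[ r < 2 * n ] level r (2 * n ∸ suc r) ≡ n + 2 + j * 4
  antiLevels = m , trans (∑-halves n (λ r → level r (2 * n ∸ suc r))) (∑-threes _ antidiagonalTile)
    where
    antidiagonal : ∀ {x} → x ≤ 2m → isDiag x (2m ∸ x) ≡ true
    antidiagonal {x} x≤2m = begin
      (x ≡ᵇ 2m ∸ x) ∨ (x + (2m ∸ x) ≡ᵇ 2m) ≡⟨ cong (λ s → (x ≡ᵇ 2m ∸ x) ∨ (s ≡ᵇ 2m)) (m+[n∸m]≡n x≤2m) ⟩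
      (x ≡ᵇ 2m ∸ x) ∨ (2m ≡ᵇ 2m)          ≡⟨ cong ((x ≡ᵇ 2m ∸ x) ∨_) (≡ᵇ-refl 2m) ⟩
      (x ≡ᵇ 2m ∸ x) ∨ true                ≡⟨ ∨-zeroʳ _ ⟩
      true                                ∎
      where open ≡-Reasoning
    antiCell : ∀ {x} → x < n → ∀ ι →
               level (fromHalf x ι) (2 * n ∸ suc (fromHalf x ι)) ≡ cell x ι (2m ∸ x) (ι ⁻¹)
    antiCell {x} x<n ι =
      trans (cong (level (fromHalf x ι)) (fromHalf-reflect n ι x<n)) (level-fromHalf x ι (2m ∸ x) (ι ⁻¹))
    antidiagonalTile : ∀ x → x < n → level (fromHalf x 0ℙ) (2 * n ∸ suc (fromHalf x 0ℙ))
                                     + level (fromHalf x 1ℙ) (2 * n ∸ suc (fromHalf x 1ℙ)) ≡ 3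
    antidiagonalTile x x<n = trans (cong₂ _+_ (antiCell x<n 0ℙ) (antiCell x<n 1ℙ))
      (cong (λ t → toℕ (tile t 0ℙ 1ℙ) + toℕ (tile t 1ℙ 0ℙ))
            (tileAt-diag x (2m ∸ x) (antidiagonal (s≤s⁻¹ x<n))))

  rowMagic : ∀ i → ΣΓ n (2 * n) (λ j → square i j) ≡ μ
  rowMagic i = magicLine _ (λ _ → toℕ i) (λ c → c) (λ _ → refl)
                         (rowLevels (toℕ i) (toℕ<n i)) (n∣∑-const ⌊ toℕ i /2⌋) n∣∑⌊/2⌋

  colMagic : ∀ j → ΣΓ n (2 * n) (λ i → square i j) ≡ μ
  colMagic j = magicLine _ (λ r → r) (λ _ → toℕ j) (λ _ → refl)
                         (colLevels (toℕ j) (toℕ<n j)) n∣∑⌊/2⌋ (n∣∑-const ⌊ toℕ j /2⌋)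

  diagMagic : ΣΓ n (2 * n) (λ i → square i i) ≡ μ
  diagMagic = magicLine _ (λ r → r) (λ r → r) (λ _ → refl) diagLevels n∣∑⌊/2⌋ n∣∑⌊/2⌋

  antiMagic : ΣΓ n (2 * n) (λ i → square i (opposite i)) ≡ μ
  antiMagic = magicLine _ (λ r → r) (λ r → 2 * n ∸ suc r) (λ i → cong (entry (toℕ i)) (opposite-prop i))
                        antiLevels n∣∑⌊/2⌋ (subst (n ∣_) (sym (∑-reverse (2 * n) ⌊_/2⌋)) n∣∑⌊/2⌋)

  n²≡1-mod-4 : (n * n) % 4 ≡ 1 % 4
  n²≡1-mod-4 = trans (cong (_% 4) (square-odd k)) ([m+kn]%n≡m%n 1 (m * m + m) 4)
    where
    square-odd : ∀ k → suc (2 * suc k) * suc (2 * suc k) ≡ 1 + (suc k * suc k + suc k) * 4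
    square-odd = solve-∀

  4-invertible-mod-n : (4 * (suc m * suc m)) % n ≡ 1 % n
  4-invertible-mod-n = trans (cong (_% n) (square-even k)) ([m+kn]%n≡m%n 1 (n + 2) n)
    where
    square-even : ∀ k → 4 * (suc (suc k) * suc (suc k))
                        ≡ 1 + (suc (2 * suc k) + 2) * suc (2 * suc k)
    square-even = solve-∀

  entry-injective : ∀ {r c r′ c′} → r < 2 * n → c < 2 * n → r′ < 2 * n → c′ < 2 * n →
                    entry r c ≡ entry r′ c′ → r ≡ r′ × c ≡ c′
  entry-injective {r} {c} {r′} {c′} r< c< r′< c′< eq =
    ⌊/2⌋-parity-injective x≡x′ (proj₁ ι≡ι′×κ≡κ′) , ⌊/2⌋-parity-injective y≡y′ (proj₂ ι≡ι′×κ≡κ′)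
    where
    y≡y′ : ⌊ c /2⌋ ≡ ⌊ c′ /2⌋
    y≡y′ = mod-injective (⌊/2⌋-< n c<) (⌊/2⌋-< n c′<) (cong proj₂ eq)
    level≡×x≡x′ : level r c ≡ level r′ c′ × ⌊ r /2⌋ ≡ ⌊ r′ /2⌋
    level≡×x≡x′ = crt-injective 4 n {u = n} {v = suc m * suc m} n²≡1-mod-4 4-invertible-mod-n
                    (toℕ<n (tile _ _ _)) (toℕ<n (tile _ _ _)) (⌊/2⌋-< n r<) (⌊/2⌋-< n r′<)
                    (fromℕ<-injective _ _ _ _ (cong proj₁ eq))
    x≡x′ : ⌊ r /2⌋ ≡ ⌊ r′ /2⌋
    x≡x′ = proj₂ level≡×x≡x′
    sameTile : tile (tileAt ⌊ r′ /2⌋ ⌊ c′ /2⌋) (parity r) (parity c)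
             ≡ tile (tileAt ⌊ r′ /2⌋ ⌊ c′ /2⌋) (parity r′) (parity c′)
    sameTile = toℕ-injective
      (subst₂ (λ x y → cell x (parity r) y (parity c) ≡ level r′ c′) x≡x′ y≡y′ (proj₁ level≡×x≡x′))
    ι≡ι′×κ≡κ′ : parity r ≡ parity r′ × parity c ≡ parity c′
    ι≡ι′×κ≡κ′ = tile-injective _ sameTile

  square-injective : Injective _≡_ _≡_ (λ (p : Fin (2 * n) × Fin (2 * n)) → square (proj₁ p) (proj₂ p))
  square-injective {i , j} {i′ , j′} eq =
    cong₂ _,_ (toℕ-injective (proj₁ r≡r′×c≡c′)) (toℕ-injective (proj₂ r≡r′×c≡c′))
    where
    r≡r′×c≡c′ : toℕ i ≡ toℕ i′ × toℕ j ≡ toℕ j′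
    r≡r′×c≡c′ = entry-injective (toℕ<n i) (toℕ<n j) (toℕ<n i′) (toℕ<n j′) eq

  square-bijective : Bijective _≡_ _≡_ (λ (p : Fin (2 * n) × Fin (2 * n)) → square (proj₁ p) (proj₂ p))
  square-bijective =
    injective⇒bijective (↔-sym *↔×) (subst (λ K → Γ n ↔ Fin K) (same-size n) (↔-sym *↔×)) square-injective
    where
    same-size : ∀ n → 4 * n * n ≡ 2 * n * (2 * n)
    same-size = solve-∀

  magic : IsMagicSquare n (2 * n) square
  magic = square-bijective , μ , rowMagic , colMagic , diagMagic , antiMagic

odd≥3⇒1+2[1+k] : ∀ N → 3 ≤ N → ¬ (2 ∣ N) → ∃ λ k → N ≡ suc (2 * suc k)
odd≥3⇒1+2[1+k] N 3≤N ¬2∣N with ⌊ N /2⌋ | parity N | fromHalf-⌊/2⌋ N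
... | x     | 0ℙ | N≡   = contradiction (divides x (trans (sym N≡) (trans (fromHalf-0ℙ x) (*-comm 2 x)))) ¬2∣N
... | zero  | 1ℙ | refl = contradiction 3≤N λ { (s≤s ()) }
... | suc k | 1ℙ | N≡   = k , trans (sym N≡) (fromHalf-1ℙ (suc k))

lemma5p3 : (n : ℕ) → .{{_ : NonZero n}} → 3 ≤ n → ¬ (2 ∣ n)
    → Σ (Fin (2 * n) → Fin (2 * n) → Γ n) (λ M → IsMagicSquare n (2 * n) M)
lemma5p3 n 3≤n ¬2∣n with odd≥3⇒1+2[1+k] n 3≤n ¬2∣n
... | k , refl = square , magic
  where open Construction k
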